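{- There is a sequence of positive constants $(a_i)_{i\ge0}$ such that the following holds. Let $G$ be a graph without isolated vertices with maximum degree $x$, let $t\ge 1$, and let $\mathbf{M}$ be a family of distant independent sets of $G$, each of size $t$, such that every satisfying assignment of $\phi(G)$ is covered by at least one member of $\mathbf{M}$. Then $|\mathbf{M}|\ge 2^{t/a_x}$.
   Context: $\phi(G)$ is the monotone 2-CNF with variables $\{x_v: v\in V(G)\}$ and clauses $(x_u\vee x_v)$ for $\{u,v\}\in E(G)$. A set $V'\subseteq V(G)$ is a distant independent set if it is independent and no two vertices of $V'$ have a common neighbour. A set $V'$ covers an assignment $S$ (a set of literals) if every variable $x_v$, $v\in V'$, occurs positively in $S$. -}

module Defs where

open import Data.Nat using (ℕ; _≤_)
open import Data.Bool using (Bool; true; false; _∨_)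
open import Data.Fin using (Fin)
open import Data.Fin.Subset using (Subset; _∈_; ∣_∣)
open import Data.Vec using (tabulate)
open import Data.Product using (_×_; ∃)
open import Data.Empty using (⊥)
open import Relation.Binary.PropositionalEquality using (_≡_; _≢_)

record Graph (n : ℕ) : Set where
  field
    adj    : Fin n → Fin n → Bool
    sym    : ∀ u v → adj u v ≡ adj v u
    irrefl : ∀ v → adj v v ≡ false
open Graph public

nbhd : ∀ {n} → Graph n → Fin n → Subset n
nbhd G v = tabulate (adj G v)

degree : ∀ {n} → Graph n → Fin n → ℕ
degree G v = ∣ nbhd G v ∣

NoIsolated : ∀ {n} → Graph n → Set
NoIsolated G = ∀ v → 1 ≤ degree G v

MaxDegree : ∀ {n} → Graph n → ℕ → Set
MaxDegree G x = (∀ v → degree G v ≤ x) × ∃ (λ v → degree G v ≡ x)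

Independent : ∀ {n} → Graph n → Subset n → Set
Independent G S = ∀ u v → u ∈ S → v ∈ S → adj G u v ≡ false

DistantIndependent : ∀ {n} → Graph n → Subset n → Set
DistantIndependent G S =
  Independent G S ×
  (∀ u v w → u ∈ S → v ∈ S → u ≢ v → adj G u w ≡ true → adj G v w ≡ true → ⊥)

-- a (total) truth assignment to the variables x_v of φ(G);
-- σ v ≡ true means the literal x_v (positive) is in the assignment
Assignment : ℕ → Set
Assignment n = Fin n → Bool

-- σ satisfies φ(G): every clause (x_u ∨ x_v), {u,v} ∈ E(G), is true
Satisfies : ∀ {n} → Graph n → Assignment n → Set
Satisfies G σ = ∀ u v → adj G u v ≡ true → (σ u ∨ σ v) ≡ true

Covers : ∀ {n} → Subset n → Assignment n → Set
Covers S σ = ∀ v → v ∈ S → σ v ≡ true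

-- For a set A of available vertices, weigh each candidate S by x^|S ∩ A| (x+1)^|S ∖ A|.
-- Choosing v ∈ A, deleting v and its neighbours from A, and discarding the candidates that
-- contain v does not increase the total weight on average over v ∈ A: v has at most one
-- neighbour in the distant set S ∩ A, and each vertex of S ∩ A has at most x neighbours.
-- As long as every independent subset of A misses some remaining candidate, induction on |A|
-- bounds the total weight below by its value (x+1)^t at A = ∅. The complement of an independent
-- set is a satisfying assignment, so this applies to M at A = V(G), where the total weight is
-- |M| x^t; then (x+1)^x ≥ 2 x^x turns (x+1)^t ≤ |M| x^t into 2^t ≤ |M|^x.
module Submission where

open import Defs
open import Data.Nat using (ℕ; _≤_; _^_)
open import Data.Fin.Subset using (Subset; ∣_∣)
open import Data.List using (List; length)
open import Data.List.Relation.Unary.All using (All)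
open import Data.List.Relation.Unary.Any using (Any)
open import Data.List.Relation.Unary.Unique.Propositional using (Unique)
open import Data.Product using (_×_; ∃)
open import Relation.Binary.PropositionalEquality using (_≡_)

open import Data.Bool using (Bool; true; false; _∧_; not; T) renaming (_≟_ to _≟ᵇ_)
open import Data.Bool.Properties using (∧-conicalˡ; ∧-conicalʳ; ∧-zeroʳ; ∧-identityʳ)
open import Data.Empty using (⊥; ⊥-elim)
open import Data.Fin using (Fin; zero; suc; _≟_)
open import Data.Fin.Properties using (any?; suc-injective)
open import Data.Fin.Subset using (_∈_; _∉_; ⁅_⁆; _∪_) renaming (⊥ to ∅)
open import Data.Fin.Subset.Properties using (∉⊥; x∈p∪q⁻; x∈p∪q⁺; x∈⁅x⁆; x∈⁅y⁆⇒x≡y)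
open import Data.List using ([]; _∷_; map; filter)
open import Data.List.Membership.Propositional using (find; lose) renaming (_∈_ to _∈ₗ_)
open import Data.List.Membership.Propositional.Properties using (∈-filter⁺)
open import Data.List.Properties using (map-cong)
import Data.List.Relation.Unary.All as All
open import Data.List.Relation.Unary.All.Properties using (filter⁺)
open import Data.List.Relation.Unary.Any using (here; there) renaming (map to Any-map)
open import Data.Nat using (zero; suc; pred; _+_; _*_; _<_; z≤n; s≤s; NonZero; >-nonZero)
open import Data.Nat.Induction using (<-wellFounded)
open import Data.Nat.ListAction using (sum)
open import Data.Nat.Properties hiding (suc-injective; _≟_)
open import Algebra.Properties.Semiring.Sum +-*-semiring
  using (sum-cong-≗; ∑-comm; ∑-distrib-+; *-distribˡ-sum; *-distribʳ-sum; sum-replicate-zero)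
  renaming (sum to ∑)
open import Data.Nat.Tactic.RingSolver using (solve-∀)
open import Data.Product using (_,_; proj₁; proj₂)
open import Data.Sum using (inj₁; inj₂)
open import Data.Vec using ([]; _∷_; lookup)
open import Data.Vec.Properties using (lookup∘tabulate; lookup⇒[]=; []=⇒lookup)
open import Function using (_∘_; _on_)
open import Induction.WellFounded using (Acc; acc)
import Relation.Binary.Construct.On as On
open import Relation.Binary.PropositionalEquality using (_≢_; refl; trans; cong; subst; module ≡-Reasoning)
import Relation.Binary.PropositionalEquality as ≡
open import Relation.Nullary using (yes; no; does)
open import Relation.Nullary.Decidable using (T?)

-- Counting with indicators

𝟙 : Bool → ℕ
𝟙 false = 0
𝟙 true  = 1

𝟙-∧ : ∀ a b → 𝟙 (a ∧ b) ≡ 𝟙 a * 𝟙 b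
𝟙-∧ false b = refl
𝟙-∧ true  b = ≡.sym (+-identityʳ (𝟙 b))

𝟙-∧-* : ∀ a b m → 𝟙 (a ∧ b) * m ≡ 𝟙 a * (𝟙 b * m)
𝟙-∧-* a b m = trans (cong (_* m) (𝟙-∧ a b)) (*-assoc (𝟙 a) (𝟙 b) m)

𝟙-*-mono-≤ : ∀ b {m m′} → (b ≡ true → m ≤ m′) → 𝟙 b * m ≤ 𝟙 b * m′
𝟙-*-mono-≤ false _    = z≤n
𝟙-*-mono-≤ true  m≤m′ = +-monoˡ-≤ 0 (m≤m′ refl)

not≡true⇒≡false : ∀ {b} → not b ≡ true → b ≡ false
not≡true⇒≡false {false} _ = refl

≢true⇒≡false : ∀ {b} → b ≢ true → b ≡ false
≢true⇒≡false {false} _       = refl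
≢true⇒≡false {true}  b≢true = ⊥-elim (b≢true refl)

∑-mono-≤ : ∀ {n} {f g : Fin n → ℕ} → (∀ i → f i ≤ g i) → ∑ f ≤ ∑ g
∑-mono-≤ {zero}  _   = z≤n
∑-mono-≤ {suc n} f≤g = +-mono-≤ (f≤g zero) (∑-mono-≤ (f≤g ∘ suc))

term≤∑ : ∀ {n} (f : Fin n → ℕ) i → f i ≤ ∑ f
term≤∑ f zero    = m≤m+n (f zero) _
term≤∑ f (suc i) = ≤-trans (term≤∑ (f ∘ suc) i) (m≤n+m _ (f zero))

infixl 7 _∩_ _─_

_∩_ _─_ : ∀ {n} → (Fin n → Bool) → (Fin n → Bool) → Fin n → Bool
(P ∩ Q) i = P i ∧ Q i
(P ─ Q) i = P i ∧ not (Q i)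

card : ∀ {n} → (Fin n → Bool) → ℕ
card P = ∑ (𝟙 ∘ P)

∣p∣≡card-lookup : ∀ {n} (p : Subset n) → ∣ p ∣ ≡ card (lookup p)
∣p∣≡card-lookup []          = refl
∣p∣≡card-lookup (true  ∷ p) = cong suc (∣p∣≡card-lookup p)
∣p∣≡card-lookup (false ∷ p) = ∣p∣≡card-lookup p

card-+ : ∀ {n} {P Q R : Fin n → Bool} →
         (∀ i → 𝟙 (P i) + 𝟙 (Q i) ≡ 𝟙 (R i)) → card P + card Q ≡ card R
card-+ {P = P} {Q} pointwise = trans (≡.sym (∑-distrib-+ (𝟙 ∘ P) (𝟙 ∘ Q))) (sum-cong-≗ pointwise)

card-∅ : ∀ {n} {P : Fin n → Bool} → (∀ i → P i ≡ false) → card P ≡ 0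
card-∅ {n} P≡false = trans (sum-cong-≗ (cong 𝟙 ∘ P≡false)) (sum-replicate-zero n)

card-─-∩ : ∀ {n} (P Q : Fin n → Bool) → card (P ─ Q) + card (Q ∩ P) ≡ card P
card-─-∩ P Q = card-+ pointwise
  where
  pointwise : ∀ i → 𝟙 ((P ─ Q) i) + 𝟙 ((Q ∩ P) i) ≡ 𝟙 (P i)
  pointwise i with P i | Q i
  ... | true  | true  = refl
  ... | true  | false = refl
  ... | false | true  = refl
  ... | false | false = refl

card-< : ∀ {n} {P Q : Fin n → Bool} → (∀ i → Q i ≡ true → P i ≡ true) →
         ∀ v → P v ≡ true → Q v ≡ false → card Q < card P
card-< {P = P} {Q} Q⊆P v Pv Qv = begin-strict
  card Q                 <⟨ m<m+n (card Q) (≤-trans (≤-reflexive v-in-difference) (term≤∑ _ v)) ⟩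
  card Q + card (P ─ Q)  ≡⟨ card-+ split ⟩
  card P                 ∎
  where
  open ≤-Reasoning
  v-in-difference : 1 ≡ 𝟙 ((P ─ Q) v)
  v-in-difference = ≡.sym (≡.cong₂ (λ a b → 𝟙 (a ∧ not b)) Pv Qv)
  split : ∀ i → 𝟙 (Q i) + 𝟙 ((P ─ Q) i) ≡ 𝟙 (P i)
  split i with Q i in Qi
  ... | true  rewrite Q⊆P i Qi = refl
  ... | false = cong 𝟙 (∧-identityʳ (P i))

card≤1 : ∀ {n} (P : Fin n → Bool) →
         (∀ i j → P i ≡ true → P j ≡ true → i ≢ j → ⊥) → card P ≤ 1
card≤1 {zero}  P _ = z≤n
card≤1 {suc n} P at-most-one with P zero in P0
... | false = card≤1 (P ∘ suc) λ i j Pi Pj i≢j → at-most-one (suc i) (suc j) Pi Pj (i≢j ∘ suc-injective)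
... | true  = ≤-reflexive (cong suc (card-∅ λ i → ≢true⇒≡false λ Pi → at-most-one zero (suc i) P0 Pi λ ()))


module _ {A : Set} where

  sum-map-mono-All : ∀ {P : A → Set} {f g : A → ℕ} {L} →
                     All P L → (∀ {a} → P a → f a ≤ g a) → sum (map f L) ≤ sum (map g L)
  sum-map-mono-All All.[]         _   = z≤n
  sum-map-mono-All (pa All.∷ pas) f≤g = +-mono-≤ (f≤g pa) (sum-map-mono-All pas f≤g)

  ∈⇒≤sum-map : ∀ (f : A → ℕ) {a L} → a ∈ₗ L → f a ≤ sum (map f L)
  ∈⇒≤sum-map f (here refl) = m≤m+n _ _
  ∈⇒≤sum-map f {L = b ∷ _} (there a∈L) = ≤-trans (∈⇒≤sum-map f a∈L) (m≤n+m _ (f b))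

  *-distribˡ-sum-map : ∀ c (f : A → ℕ) L → c * sum (map f L) ≡ sum (map (λ a → c * f a) L)
  *-distribˡ-sum-map c f []      = *-zeroʳ c
  *-distribˡ-sum-map c f (a ∷ L) =
    trans (*-distribˡ-+ c (f a) _) (cong (c * f a +_) (*-distribˡ-sum-map c f L))

  ∑-sum-map-comm : ∀ {n} (f : Fin n → A → ℕ) L →
                   ∑ (λ i → sum (map (f i) L)) ≡ sum (map (λ a → ∑ (λ i → f i a)) L)
  ∑-sum-map-comm {n} f []      = sum-replicate-zero n
  ∑-sum-map-comm     f (a ∷ L) =
    trans (∑-distrib-+ (λ i → f i a) _) (cong (∑ (λ i → f i a) +_) (∑-sum-map-comm f L))

  sum-map-filter : ∀ (p : A → Bool) (f : A → ℕ) L →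
                   sum (map f (filter (T? ∘ p) L)) ≡ sum (map (λ a → 𝟙 (p a) * f a) L)
  sum-map-filter p f []      = refl
  sum-map-filter p f (a ∷ L) with p a
  ... | true  = ≡.cong₂ _+_ (≡.sym (+-identityʳ (f a))) (sum-map-filter p f L)
  ... | false = sum-map-filter p f L

^-distribʳ-* : ∀ m n o → (m * n) ^ o ≡ m ^ o * n ^ o
^-distribʳ-* m n zero    = refl
^-distribʳ-* m n (suc o) = trans (cong (m * n *_) (^-distribʳ-* m n o)) (lemma m n (m ^ o) (n ^ o))
  where
  lemma : ∀ m n p q → m * n * (p * q) ≡ m * p * (n * q)
  lemma = solve-∀

-- Bernoulli's inequality (1 + 1/x)^k ≥ 1 + k/x, cleared of denominators.
bernoulli : ∀ x k → x ^ k * (x + k) ≤ x * suc x ^ k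
bernoulli x zero    = ≤-reflexive (lemma x)
  where
  lemma : ∀ x → 1 * (x + 0) ≡ x * 1
  lemma = solve-∀
bernoulli x (suc k) = begin
  x * x ^ k * (x + suc k)              ≡⟨ expand x (x ^ k) k ⟩
  x * (x ^ k * (x + k)) + x * x ^ k    ≤⟨ +-mono-≤ (*-monoʳ-≤ x (bernoulli x k)) (*-monoʳ-≤ x x^k≤[1+x]^k) ⟩
  x * (x * suc x ^ k) + x * suc x ^ k  ≡⟨ collect x (suc x ^ k) ⟩
  x * (suc x * suc x ^ k)              ∎
  where
  open ≤-Reasoning
  x^k≤[1+x]^k : x ^ k ≤ suc x ^ k
  x^k≤[1+x]^k = ^-monoˡ-≤ k (n≤1+n x)
  expand : ∀ x p k → x * p * (x + suc k) ≡ x * (p * (x + k)) + x * p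
  expand = solve-∀
  collect : ∀ x q → x * (x * q) + x * q ≡ x * (suc x * q)
  collect = solve-∀

2*x^x≤[1+x]^x : ∀ x .{{_ : NonZero x}} → 2 * x ^ x ≤ suc x ^ x
2*x^x≤[1+x]^x x = *-cancelˡ-≤ x (subst (_≤ x * suc x ^ x) (lemma x (x ^ x)) (bernoulli x x))
  where
  lemma : ∀ x p → p * (x + x) ≡ x * (2 * p)
  lemma = solve-∀

-- Raise both sides to the power x, then use (1 + x)^x ≥ 2 x^x to cancel x^(t x).
2^t≤m^x : ∀ x m t .{{_ : NonZero x}} → suc x ^ t ≤ m * x ^ t → 2 ^ t ≤ m ^ x
2^t≤m^x x m t bound = *-cancelʳ-≤ (2 ^ t) (m ^ x) ((x ^ x) ^ t) {{m^n≢0 (x ^ x) t {{m^n≢0 x x}}}} (begin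
  2 ^ t * (x ^ x) ^ t  ≡⟨ ^-distribʳ-* 2 (x ^ x) t ⟨
  (2 * x ^ x) ^ t      ≤⟨ ^-monoˡ-≤ t (2*x^x≤[1+x]^x x) ⟩
  (suc x ^ x) ^ t      ≡⟨ swap-exponents (suc x) ⟩
  (suc x ^ t) ^ x      ≤⟨ ^-monoˡ-≤ x bound ⟩
  (m * x ^ t) ^ x      ≡⟨ ^-distribʳ-* m (x ^ t) x ⟩
  m ^ x * (x ^ t) ^ x  ≡⟨ cong (m ^ x *_) (swap-exponents x) ⟨
  m ^ x * (x ^ x) ^ t  ∎)
  where
  open ≤-Reasoning
  swap-exponents : ∀ b → (b ^ x) ^ t ≡ (b ^ t) ^ x
  swap-exponents b = trans (^-*-assoc b x t) (trans (cong (b ^_) (*-comm x t)) (≡.sym (^-*-assoc b t x)))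

-- The weighting argument

Disjoint : ∀ {n} → Subset n → Subset n → Set
Disjoint S F = ∀ u → u ∈ S → u ∉ F

module _ {n} (G : Graph n) where

  degree≡card : ∀ v → degree G v ≡ card (adj G v)
  degree≡card v = trans (∣p∣≡card-lookup (nbhd G v)) (sum-cong-≗ (cong 𝟙 ∘ lookup∘tabulate (adj G v)))

  degreeIn : (Fin n → Bool) → Fin n → ℕ
  degreeIn X v = card (X ∩ adj G v)

  degreeIn≤1 : ∀ {S} → DistantIndependent G S → ∀ A v → degreeIn (lookup S ∩ A) v ≤ 1
  degreeIn≤1 {S} (_ , distant) A v = card≤1 _ λ s s′ vs vs′ s≢s′ →
    distant s s′ v (in-S s vs) (in-S s′ vs′) s≢s′ (adjacent s vs) (adjacent s′ vs′)
    where
    in-S : ∀ s → (lookup S ∩ A ∩ adj G v) s ≡ true → s ∈ S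
    in-S s vs = lookup⇒[]= s S (∧-conicalˡ _ _ (∧-conicalˡ _ _ vs))
    adjacent : ∀ s → (lookup S ∩ A ∩ adj G v) s ≡ true → adj G s v ≡ true
    adjacent s vs = trans (sym G s v) (∧-conicalʳ _ _ vs)

  _⊖_ : (Fin n → Bool) → Fin n → Fin n → Bool
  (A ⊖ v) u = A u ∧ not (adj G v u) ∧ not (does (u ≟ v))

  ⊖-⊆ : ∀ A v u → (A ⊖ v) u ≡ true → A u ≡ true
  ⊖-⊆ A v u = ∧-conicalˡ _ _

  ⊖-non-adjacent : ∀ A v u → (A ⊖ v) u ≡ true → adj G v u ≡ false
  ⊖-non-adjacent A v u A⊖v∋u = not≡true⇒≡false (∧-conicalˡ _ _ (∧-conicalʳ (A u) _ A⊖v∋u))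

  card-⊖< : ∀ {A v} → A v ≡ true → card (A ⊖ v) < card A
  card-⊖< {A} {v} Av = card-< (⊖-⊆ A v) v Av v∉A⊖v
    where
    v∉A⊖v : (A ⊖ v) v ≡ false
    v∉A⊖v rewrite irrefl G v with v ≟ v
    ... | yes _   = ∧-zeroʳ (A v)
    ... | no v≢v = ⊥-elim (v≢v refl)

  card-∩-⊖ : ∀ {S A v} → lookup S v ≡ false →
             degreeIn (lookup S ∩ A) v + card (lookup S ∩ (A ⊖ v)) ≡ card (lookup S ∩ A)
  card-∩-⊖ {S} {A} {v} Sv = card-+ pointwise
    where
    pointwise : ∀ i → 𝟙 ((lookup S ∩ A ∩ adj G v) i) + 𝟙 ((lookup S ∩ (A ⊖ v)) i) ≡ 𝟙 ((lookup S ∩ A) i)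
    pointwise i with i ≟ v
    ... | yes refl rewrite Sv = refl
    ... | no _ with lookup S i | A i | adj G v i
    ... | false | _     | _     = refl
    ... | true  | false | _     = refl
    ... | true  | true  | true  = refl
    ... | true  | true  | false = refl

  card-─-⊖ : ∀ {S A v} → lookup S v ≡ false →
             degreeIn (lookup S ∩ A) v + card (lookup S ─ A) ≡ card (lookup S ─ (A ⊖ v))
  card-─-⊖ {S} {A} {v} Sv = card-+ pointwise
    where
    pointwise : ∀ i → 𝟙 ((lookup S ∩ A ∩ adj G v) i) + 𝟙 ((lookup S ─ A) i) ≡ 𝟙 ((lookup S ─ (A ⊖ v)) i)
    pointwise i with i ≟ v
    ... | yes refl rewrite Sv = refl
    ... | no _ with lookup S i | A i | adj G v i
    ... | false | _     | _     = refl
    ... | true  | false | _     = refl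
    ... | true  | true  | true  = refl
    ... | true  | true  | false = refl

  MissesIndependentSets : (Fin n → Bool) → List (Subset n) → Set
  MissesIndependentSets A L =
    ∀ F → (∀ u → u ∈ F → A u ≡ true) → Independent G F → Any (λ S → Disjoint S F) L

  avoiding : Fin n → List (Subset n) → List (Subset n)
  avoiding v = filter (T? ∘ λ S → not (lookup S v))

  -- An independent F inside A ⊖ v extends to the independent set F ∪ {v} inside A.
  misses-⊖ : ∀ {A L v} → A v ≡ true → MissesIndependentSets A L →
             MissesIndependentSets (A ⊖ v) (avoiding v L)
  misses-⊖ {A} {L} {v} Av misses F F⊆A⊖v F-independent =
    let S , S∈L , disjoint = find (misses (F ∪ ⁅ v ⁆) F+v⊆A F+v-independent)
    in lose (∈-filter⁺ _ S∈L (v∉S S disjoint)) λ u u∈S u∈F → disjoint u u∈S (x∈p∪q⁺ (inj₁ u∈F))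
    where
    F+v⊆A : ∀ u → u ∈ F ∪ ⁅ v ⁆ → A u ≡ true
    F+v⊆A u u∈F+v with x∈p∪q⁻ F ⁅ v ⁆ u∈F+v
    ... | inj₁ u∈F = ⊖-⊆ A v u (F⊆A⊖v u u∈F)
    ... | inj₂ u∈v rewrite x∈⁅y⁆⇒x≡y v u∈v = Av
    F∌nbr : ∀ u → u ∈ F → adj G u v ≡ false
    F∌nbr u u∈F = trans (sym G u v) (⊖-non-adjacent A v u (F⊆A⊖v u u∈F))
    F+v-independent : Independent G (F ∪ ⁅ v ⁆)
    F+v-independent u w u∈ w∈ with x∈p∪q⁻ F ⁅ v ⁆ u∈ | x∈p∪q⁻ F ⁅ v ⁆ w∈
    ... | inj₁ u∈F | inj₁ w∈F = F-independent u w u∈F w∈F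
    ... | inj₁ u∈F | inj₂ w∈v rewrite x∈⁅y⁆⇒x≡y v w∈v = F∌nbr u u∈F
    ... | inj₂ u∈v | inj₁ w∈F rewrite x∈⁅y⁆⇒x≡y v u∈v = trans (sym G v w) (F∌nbr w w∈F)
    ... | inj₂ u∈v | inj₂ w∈v rewrite x∈⁅y⁆⇒x≡y v u∈v | x∈⁅y⁆⇒x≡y v w∈v = irrefl G v
    v∉S : ∀ S → Disjoint S (F ∪ ⁅ v ⁆) → T (not (lookup S v))
    v∉S S disjoint with lookup S v in Sv
    ... | false = _
    ... | true  = ⊥-elim (disjoint v (lookup⇒[]= v S Sv) (x∈p∪q⁺ (inj₂ (x∈⁅x⁆ v))))

  complement-satisfies : ∀ {F} → Independent G F → Satisfies G (λ v → not (lookup F v))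
  complement-satisfies {F} F-independent u v uv with lookup F u in Fu | lookup F v in Fv
  ... | false | _     = refl
  ... | true  | false = refl
  ... | true  | true
    with () ← trans (≡.sym uv) (F-independent u v (lookup⇒[]= u F Fu) (lookup⇒[]= v F Fv))

  covering⇒misses : ∀ {L} → (∀ σ → Satisfies G σ → Any (λ S → Covers S σ) L) →
                    MissesIndependentSets (λ _ → true) L
  covering⇒misses covered F _ F-independent =
    Any-map disjoint (covered _ (complement-satisfies F-independent))
    where
    disjoint : ∀ {S} → Covers S (λ v → not (lookup F v)) → Disjoint S F
    disjoint covers u u∈S u∈F with () ← trans (cong not (≡.sym ([]=⇒lookup u∈F))) (covers u u∈S)

  module _ (x : ℕ) where

    weight : (Fin n → Bool) → Subset n → ℕ
    weight A S = x ^ card (lookup S ∩ A) * suc x ^ card (lookup S ─ A)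

    potential : (Fin n → Bool) → List (Subset n) → ℕ
    potential A L = sum (map (weight A) L)

    weight-∅ : ∀ {A} S → (∀ v → A v ≡ false) → weight A S ≡ suc x ^ ∣ S ∣
    weight-∅ {A} S A≡false = begin
      x ^ card (lookup S ∩ A) * suc x ^ card (lookup S ─ A)
        ≡⟨ ≡.cong₂ (λ a r → x ^ a * suc x ^ r) (card-∅ S∩A≡false) (sum-cong-≗ S─A≡S) ⟩
      1 * suc x ^ card (lookup S)  ≡⟨ *-identityˡ _ ⟩
      suc x ^ card (lookup S)      ≡⟨ cong (suc x ^_) (∣p∣≡card-lookup S) ⟨
      suc x ^ ∣ S ∣                ∎
      where
      open ≡-Reasoning
      S∩A≡false : ∀ i → (lookup S ∩ A) i ≡ false
      S∩A≡false i rewrite A≡false i = ∧-zeroʳ (lookup S i)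
      S─A≡S : ∀ i → 𝟙 ((lookup S ─ A) i) ≡ 𝟙 (lookup S i)
      S─A≡S i rewrite A≡false i = cong 𝟙 (∧-identityʳ (lookup S i))

    weight-full : ∀ S → weight (λ _ → true) S ≡ x ^ ∣ S ∣
    weight-full S = begin
      x ^ card (lookup S ∩ (λ _ → true)) * suc x ^ card (lookup S ─ (λ _ → true))
        ≡⟨ ≡.cong₂ (λ a r → x ^ a * suc x ^ r) (sum-cong-≗ S∩V≡S) (card-∅ (∧-zeroʳ ∘ lookup S)) ⟩
      x ^ card (lookup S) * 1  ≡⟨ *-identityʳ _ ⟩
      x ^ card (lookup S)      ≡⟨ cong (x ^_) (∣p∣≡card-lookup S) ⟨
      x ^ ∣ S ∣                ∎
      where
      open ≡-Reasoning
      S∩V≡S : ∀ i → 𝟙 ((lookup S ∩ (λ _ → true)) i) ≡ 𝟙 (lookup S i)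
      S∩V≡S i = cong 𝟙 (∧-identityʳ (lookup S i))

    potential-full : ∀ {t L} → All (λ S → ∣ S ∣ ≡ t) L → potential (λ _ → true) L ≡ length L * x ^ t
    potential-full All.[]                   = refl
    potential-full {L = S ∷ _} (∣S∣≡t All.∷ ps) =
      ≡.cong₂ _+_ (trans (weight-full S) (cong (x ^_) ∣S∣≡t)) (potential-full ps)

    potential-∅ : ∀ {t A L} → (∀ v → A v ≡ false) → All (λ S → ∣ S ∣ ≡ t) L →
                  MissesIndependentSets A L → suc x ^ t ≤ potential A L
    potential-∅ {t} {A} {L} A≡false sizes misses =
      let S , S∈L , _ = find (misses ∅ (λ _ u∈∅ → ⊥-elim (∉⊥ u∈∅)) λ _ _ u∈∅ → ⊥-elim (∉⊥ u∈∅))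
      in begin
        suc x ^ t          ≡⟨ cong (suc x ^_) (All.lookup sizes S∈L) ⟨
        suc x ^ ∣ S ∣      ≡⟨ weight-∅ S A≡false ⟨
        weight A S         ≤⟨ ∈⇒≤sum-map (weight A) S∈L ⟩
        potential A L      ∎
      where open ≤-Reasoning

    -- Deleting v and its d ≤ 1 neighbours in S ∩ A moves d vertices of S from the x-part to the (x + 1)-part.
    weight-⊖ : ∀ {A S v} → lookup S v ≡ false → degreeIn (lookup S ∩ A) v ≤ 1 →
               x * weight (A ⊖ v) S ≡ (x + degreeIn (lookup S ∩ A) v) * weight A S
    weight-⊖ {A} {S} {v} Sv d≤1 = begin
      x * weight (A ⊖ v) S                  ≡⟨ cong (λ k → x * (x ^ a′ * suc x ^ k)) (card-─-⊖ {S} {A} Sv) ⟨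
      x * (x ^ a′ * suc x ^ (d + r))        ≡⟨ shift d≤1 ⟩
      (x + d) * (x ^ (d + a′) * suc x ^ r)  ≡⟨ cong (λ k → (x + d) * (x ^ k * suc x ^ r)) (card-∩-⊖ {S} {A} Sv) ⟩
      (x + d) * weight A S                  ∎
      where
      open ≡-Reasoning
      d a′ r : ℕ
      d  = degreeIn (lookup S ∩ A) v
      a′ = card (lookup S ∩ (A ⊖ v))
      r  = card (lookup S ─ A)
      shift : ∀ {d} → d ≤ 1 → x * (x ^ a′ * suc x ^ (d + r)) ≡ (x + d) * (x ^ (d + a′) * suc x ^ r)
      shift {zero}        _         = cong (_* (x ^ a′ * suc x ^ r)) (≡.sym (+-identityʳ x))
      shift {suc zero}    _         = lemma x (x ^ a′) (suc x ^ r)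
        where
        lemma : ∀ x p q → x * (p * (suc x * q)) ≡ (x + 1) * (x * p * q)
        lemma = solve-∀
      shift {suc (suc _)} (s≤s ())

    module _ (degree≤x : ∀ v → degree G v ≤ x) where

      ∑-degreeIn≤ : ∀ X → ∑ (degreeIn X) ≤ card X * x
      ∑-degreeIn≤ X = begin
        ∑ (λ v → ∑ (λ s → 𝟙 (X s ∧ adj G v s)))     ≡⟨ ∑-comm (λ v s → 𝟙 (X s ∧ adj G v s)) ⟩
        ∑ (λ s → ∑ (λ v → 𝟙 (X s ∧ adj G v s)))     ≡⟨ sum-cong-≗ factor ⟩
        ∑ (λ s → 𝟙 (X s) * card (λ v → adj G v s))  ≤⟨ ∑-mono-≤ (λ s → *-monoʳ-≤ (𝟙 (X s)) (in-degree≤x s)) ⟩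
        ∑ (λ s → 𝟙 (X s) * x)                       ≡⟨ *-distribʳ-sum x (𝟙 ∘ X) ⟨
        card X * x                                  ∎
        where
        open ≤-Reasoning
        factor : ∀ s → ∑ (λ v → 𝟙 (X s ∧ adj G v s)) ≡ 𝟙 (X s) * card (λ v → adj G v s)
        factor s = trans (sum-cong-≗ (𝟙-∧ (X s) ∘ λ v → adj G v s))
                         (≡.sym (*-distribˡ-sum (𝟙 (X s)) (λ v → 𝟙 (adj G v s))))
        in-degree≤x : ∀ s → card (λ v → adj G v s) ≤ x
        in-degree≤x s = begin
          card (λ v → adj G v s)  ≡⟨ sum-cong-≗ (cong 𝟙 ∘ λ v → sym G v s) ⟩
          card (adj G s)          ≡⟨ degree≡card s ⟨
          degree G s              ≤⟨ degree≤x s ⟩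
          x                       ∎

      -- Summing weight-⊖ over v ∈ A ─ S, every vertex of S ∩ A is counted at most x times.
      weight-average : .{{_ : NonZero x}} → ∀ A {S} → DistantIndependent G S →
                       ∑ (λ v → 𝟙 ((A ─ lookup S) v) * weight (A ⊖ v) S) ≤ card A * weight A S
      weight-average A {S} distant = *-cancelˡ-≤ x (begin
        x * ∑ (λ v → 𝟙 (B v) * weight (A ⊖ v) S)    ≡⟨ *-distribˡ-sum {n} x _ ⟩
        ∑ (λ v → x * (𝟙 (B v) * weight (A ⊖ v) S))  ≤⟨ ∑-mono-≤ pointwise ⟩
        ∑ (λ v → (𝟙 (B v) * x + d v) * w)           ≡⟨ *-distribʳ-sum w (λ v → 𝟙 (B v) * x + d v) ⟨
        ∑ (λ v → 𝟙 (B v) * x + d v) * w             ≤⟨ *-monoˡ-≤ w counting ⟩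
        card A * x * w                              ≡⟨ cong (_* w) (*-comm (card A) x) ⟩
        x * card A * w                              ≡⟨ *-assoc x (card A) w ⟩
        x * (card A * w)                            ∎)
        where
        open ≤-Reasoning
        B : Fin n → Bool
        B = A ─ lookup S
        d : Fin n → ℕ
        d = degreeIn (lookup S ∩ A)
        w : ℕ
        w = weight A S
        pointwise : ∀ v → x * (𝟙 (B v) * weight (A ⊖ v) S) ≤ (𝟙 (B v) * x + d v) * w
        pointwise v with B v in Bv
        ... | false = ≤-trans (≤-reflexive (*-zeroʳ x)) z≤n
        ... | true  = ≤-reflexive (begin-equality
          x * (1 * weight (A ⊖ v) S)  ≡⟨ cong (x *_) (*-identityˡ _) ⟩
          x * weight (A ⊖ v) S        ≡⟨ weight-⊖ {A} {S} v∉S (degreeIn≤1 distant A v) ⟩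
          (x + d v) * w               ≡⟨ cong (λ k → (k + d v) * w) (*-identityˡ x) ⟨
          (1 * x + d v) * w           ∎)
          where
          v∉S : lookup S v ≡ false
          v∉S = not≡true⇒≡false (∧-conicalʳ (A v) _ Bv)
        counting : ∑ (λ v → 𝟙 (B v) * x + d v) ≤ card A * x
        counting = begin
          ∑ (λ v → 𝟙 (B v) * x + d v)                ≡⟨ ∑-distrib-+ (λ v → 𝟙 (B v) * x) d ⟩
          ∑ (λ v → 𝟙 (B v) * x) + ∑ d                ≡⟨ cong (_+ ∑ d) (*-distribʳ-sum x (𝟙 ∘ B)) ⟨
          card B * x + ∑ d                           ≤⟨ +-monoʳ-≤ (card B * x) (∑-degreeIn≤ (lookup S ∩ A)) ⟩
          card B * x + card (lookup S ∩ A) * x       ≡⟨ *-distribʳ-+ x (card B) _ ⟨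
          (card B + card (lookup S ∩ A)) * x         ≡⟨ cong (_* x) (card-─-∩ A (lookup S)) ⟩
          card A * x                                 ∎

      potential-average : .{{_ : NonZero x}} → ∀ A {L} → All (DistantIndependent G) L →
                          ∑ (λ v → 𝟙 (A v) * potential (A ⊖ v) (avoiding v L)) ≤ card A * potential A L
      potential-average A {L} distant = begin
        ∑ (λ v → 𝟙 (A v) * potential (A ⊖ v) (avoiding v L))
          ≡⟨ sum-cong-≗ (λ v → trans (cong (𝟙 (A v) *_) (sum-map-filter _ _ L))
                                     (*-distribˡ-sum-map (𝟙 (A v)) _ L)) ⟩
        ∑ (λ v → sum (map (λ S → 𝟙 (A v) * (𝟙 (not (lookup S v)) * weight (A ⊖ v) S)) L))
          ≡⟨ ∑-sum-map-comm (λ v S → 𝟙 (A v) * (𝟙 (not (lookup S v)) * weight (A ⊖ v) S)) L ⟩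
        sum (map (λ S → ∑ (λ v → 𝟙 (A v) * (𝟙 (not (lookup S v)) * weight (A ⊖ v) S))) L)
          ≡⟨ cong sum (map-cong (λ S → sum-cong-≗ λ v → 𝟙-∧-* (A v) _ _) L) ⟨
        sum (map (λ S → ∑ (λ v → 𝟙 ((A ─ lookup S) v) * weight (A ⊖ v) S)) L)
          ≤⟨ sum-map-mono-All distant (weight-average A) ⟩
        sum (map (λ S → card A * weight A S) L)
          ≡⟨ *-distribˡ-sum-map (card A) (weight A) L ⟨
        card A * potential A L
          ∎
        where open ≤-Reasoning

      potential-bound : .{{_ : NonZero x}} → ∀ t A L → All (λ S → DistantIndependent G S × ∣ S ∣ ≡ t) L →
                        MissesIndependentSets A L → suc x ^ t ≤ potential A L
      potential-bound t A = go A (On.wellFounded card <-wellFounded A)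
        where
        go : ∀ A → Acc (_<_ on card) A → ∀ L → All (λ S → DistantIndependent G S × ∣ S ∣ ≡ t) L →
             MissesIndependentSets A L → suc x ^ t ≤ potential A L
        go A (acc smaller) L good misses with any? (λ v → A v ≟ᵇ true)
        ... | no ∄v = potential-∅ (λ v → ≢true⇒≡false λ Av → ∄v (v , Av)) (All.map proj₂ good) misses
        ... | yes (v , Av) = *-cancelˡ-≤ (card A) {{>-nonZero (≤-trans (s≤s z≤n) (card-⊖< Av))}} (begin
          card A * suc x ^ t                                      ≡⟨ *-distribʳ-sum (suc x ^ t) (𝟙 ∘ A) ⟩
          ∑ (λ u → 𝟙 (A u) * suc x ^ t)                           ≤⟨ ∑-mono-≤ (λ u → 𝟙-*-mono-≤ (A u) (induction u)) ⟩
          ∑ (λ u → 𝟙 (A u) * potential (A ⊖ u) (avoiding u L))    ≤⟨ potential-average A (All.map proj₁ good) ⟩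
          card A * potential A L                                  ∎)
          where
          open ≤-Reasoning
          induction : ∀ u → A u ≡ true → suc x ^ t ≤ potential (A ⊖ u) (avoiding u L)
          induction u Au = go (A ⊖ u) (smaller (card-⊖< Au)) (avoiding u L)
                              (filter⁺ (T? ∘ λ S → not (lookup S u)) good) (misses-⊖ Au misses)

covering-family-bound : ∀ {n} (G : Graph n) {x t M} .{{_ : NonZero x}} → (∀ v → degree G v ≤ x) →
                        All (λ S → DistantIndependent G S × ∣ S ∣ ≡ t) M →
                        (∀ σ → Satisfies G σ → Any (λ S → Covers S σ) M) →
                        2 ^ t ≤ length M ^ x
covering-family-bound {n} G {x} {t} {M} degree≤x good covered = 2^t≤m^x x (length M) t (begin
  suc x ^ t                     ≤⟨ potential-bound G x degree≤x t V M good (covering⇒misses G covered) ⟩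
  potential G x V M             ≡⟨ potential-full G x (All.map proj₂ good) ⟩
  length M * x ^ t              ∎)
  where
  open ≤-Reasoning
  V : Fin n → Bool
  V _ = true

exponent : ℕ → ℕ
exponent x = suc (pred x)

lemma1 : ∃ λ (a : ℕ → ℕ) → (∀ i → 1 ≤ a i) ×
           (∀ (n : ℕ) (G : Graph n) (x t : ℕ) (M : List (Subset n)) →
              NoIsolated G → MaxDegree G x → 1 ≤ t →
              Unique M →
              All (λ S → DistantIndependent G S × ∣ S ∣ ≡ t) M →
              (∀ σ → Satisfies G σ → Any (λ S → Covers S σ) M) →
              2 ^ t ≤ length M ^ a x)
lemma1 = exponent , (λ _ → s≤s z≤n) ,
  λ n G x t M no-isolated (degree≤x , v₀ , degree-v₀≡x) _ _ good covered →
    let x≢0 = >-nonZero (subst (1 ≤_) degree-v₀≡x (no-isolated v₀))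
    in subst (λ e → 2 ^ t ≤ length M ^ e) (≡.sym (suc-pred x {{x≢0}}))
             (covering-family-bound G {{x≢0}} degree≤x good covered)
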